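{- Let $m\ge 1$ be an integer. Then $m(K^1_{m,m},t)\le m(K^1_{2m-1,1},t)$ for all $t=0,1,\dots,m$, and $m(K^1_{m+1,m},t)\le m(K^1_{2m,1},t)$ for all $t=0,1,\dots,m$.
   Context: $m(G,t)$ is the number of $t$-matchings (sets of $t$ pairwise disjoint edges) of $G$, $m(G,0)=1$. For positive integers $a\ge b$, $K^1_{a,b}$ denotes the graph obtained from the disjoint union $K_a\cup K_b$ by adding one edge joining a vertex of $K_a$ to a vertex of $K_b$. -}

module Defs where

open import Data.Nat using (ℕ; zero; suc; _+_; _<ᵇ_; _≡ᵇ_)
open import Data.Bool using (Bool; true; false; _∧_; _∨_; not; if_then_else_)
open import Data.Fin using (Fin; toℕ)
open import Data.List using (List; []; _∷_; length; filterᵇ; allFin; concatMap; map; _++_)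
open import Data.Product using (_×_; _,_)

-- A finite simple graph on vertex set Fin n, given by a Boolean adjacency
-- relation (assumed symmetric and irreflexive; only pairs i < j are read).
record Graph : Set where
  field
    order : ℕ
    adj   : Fin order → Fin order → Bool
open Graph public

edges : (G : Graph) → List (Fin (order G) × Fin (order G))
edges G = concatMap (λ i → concatMap (λ j →
            if (toℕ i <ᵇ toℕ j) ∧ adj G i j then (i , j) ∷ [] else [])
            (allFin (order G))) (allFin (order G))

-- all sub-lists (= subsets, since the edge list has no duplicates)
sublists : {A : Set} → List A → List (List A)
sublists []       = [] ∷ []
sublists (x ∷ xs) = let r = sublists xs in map (x ∷_) r ++ r

module _ {n : ℕ} where
  sharesVertex : Fin n × Fin n → Fin n × Fin n → Bool
  sharesVertex (a , b) (c , d) =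
    (toℕ a ≡ᵇ toℕ c) ∨ (toℕ a ≡ᵇ toℕ d) ∨ (toℕ b ≡ᵇ toℕ c) ∨ (toℕ b ≡ᵇ toℕ d)

  anyB : {A : Set} → (A → Bool) → List A → Bool
  anyB p []       = false
  anyB p (x ∷ xs) = p x ∨ anyB p xs

  isMatching : List (Fin n × Fin n) → Bool
  isMatching []       = true
  isMatching (e ∷ es) = not (anyB (sharesVertex e) es) ∧ isMatching es

matchings : Graph → ℕ → ℕ
matchings G t = length (filterᵇ (λ s → (length s ≡ᵇ t) ∧ isMatching s) (sublists (edges G)))



-- K^1_{a,b}: vertices 0..a-1 form K_a, vertices a..a+b-1 form K_b, plus the
-- single extra edge joining vertex 0 (in K_a) to vertex a (in K_b).
K1 : ℕ → ℕ → Graph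
K1 a b = record { order = a + b ; adj = λ i j → ad (toℕ i) (toℕ j) }
  where
    ad : ℕ → ℕ → Bool
    ad x y = not (x ≡ᵇ y) ∧
             ( ((x <ᵇ a) ∧ (y <ᵇ a))
             ∨ (not (x <ᵇ a) ∧ not (y <ᵇ a))
             ∨ ((x ≡ᵇ 0) ∧ (y ≡ᵇ a))
             ∨ ((x ≡ᵇ a) ∧ (y ≡ᵇ 0)) )

module Submission where

open import Defs
open import Data.Bool using (Bool; true; false; _∧_; _∨_; not; if_then_else_; T)
open import Data.Bool.Properties using (∧-assoc; ∧-comm; ∨-zeroʳ)
open import Data.List using (List; []; _∷_; length; filterᵇ; map; _++_; concatMap; tabulate; allFin)
open import Data.Bool.ListAction using (all)
open import Data.Nat.ListAction using (sum)
open import Data.List.Properties using (length-++; length-map; map-++; map-∘; filter-++; ++-assoc; ++-identityʳ;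
  map-tabulate; map-concatMap; concatMap-cong; concatMap-map; concatMap-++)
import Data.List.Relation.Unary.All.Properties as All
import Data.List.Relation.Unary.Unique.Propositional.Properties as Unique
open import Data.Nat using (ℕ; zero; suc; _+_; _*_; _∸_; _≤_; _<_; z≤n; s≤s; z<s; _≡ᵇ_; _<ᵇ_)
open import Data.Product using (_×_; _,_; proj₁; proj₂)
open import Data.Sum using (_⊎_; inj₁; inj₂)
open import Data.Unit using (tt)
open import Data.List.Relation.Unary.All as All using (All; []; _∷_)
open import Data.List.Relation.Unary.Any using (here; there)
open import Data.List.Membership.Propositional using (_∈_)
open import Data.List.Relation.Unary.Unique.Propositional using (Unique)
open import Data.List.Relation.Unary.AllPairs using ([]; _∷_)
open import Data.Fin as Fin using (Fin; toℕ)
open import Function using (_∘_; id)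
open import Relation.Binary.PropositionalEquality
open import Relation.Nullary.Decidable using (T?)
open import Relation.Nullary using (contradiction)
open import Data.Nat.Tactic.RingSolver using (solve-∀)
open import Data.Nat.Properties using (≡ᵇ⇒≡; ≡⇒≡ᵇ; +-identityʳ; +-comm; +-assoc; +-suc; suc-injective;
  ≤-refl; ≤-trans; ≤-reflexive; <⇒≤; <⇒≢; <-≤-trans; <-trans; ≤⇒≯; ≤-pred; m≤n⇒m<n∨m≡n;
  m<m+n; m≤m+n; n≤1+n; m≤n+m; +-mono-≤; +-monoʳ-≤; *-monoʳ-≤; module ≤-Reasoning;
  m+[n∸m]≡n; m+n∸m≡n; m∸n+n≡m; +-∸-assoc; <⇒<ᵇ; <ᵇ⇒<)

-- Write K(a,b) for K^1_{a,b}.  Deleting the bridge edge gives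
--   m(K(a,b), t+1) = m(K_a ⊔ K_b, t+1) + m(K_{a-1} ⊔ K_{b-1}, t),
-- and the matchings of "K_n beside a graph H" satisfy the vertex recurrence
--   m(K_{n+1} ⊔ H, t+1) = m(K_n ⊔ H, t+1) + n · m(K_{n-1} ⊔ H, t).  The inequality
--   m(K(a,b), t) ≤ m(K(a+b-1,1), t)       for all a, b ≥ 1 and all t
-- follows from these recurrences by induction on a (mK1-merge), and the
-- theorem is its two instances (a,b) = (m,m) and (m+1,m).

≡ᵇ-refl : ∀ m → (m ≡ᵇ m) ≡ true
≡ᵇ-refl m = T⇒≡true (≡⇒≡ᵇ m m refl)
  where
    T⇒≡true : ∀ {b} → T b → b ≡ true
    T⇒≡true {true} _ = refl

≡ᵇ-≢ : ∀ {m n} → m ≢ n → (m ≡ᵇ n) ≡ false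
≡ᵇ-≢ {m} {n} m≢n with m ≡ᵇ n in eq
... | false = refl
... | true  = contradiction (≡ᵇ⇒≡ m n (subst T (sym eq) tt)) m≢n

<ᵇ-true : ∀ {m n} → m < n → (m <ᵇ n) ≡ true
<ᵇ-true {m} {n} m<n with m <ᵇ n | <⇒<ᵇ m<n
... | true | _ = refl

<ᵇ-false : ∀ {m n} → n ≤ m → (m <ᵇ n) ≡ false
<ᵇ-false {m} {n} n≤m with m <ᵇ n in eq
... | false = refl
... | true  = contradiction (<ᵇ⇒< m n (subst T (sym eq) tt)) (≤⇒≯ n≤m)

filterᵇ-map : {A B : Set} (p : B → Bool) (f : A → B) (xs : List A) →
  filterᵇ p (map f xs) ≡ map f (filterᵇ (p ∘ f) xs)
filterᵇ-map p f [] = refl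
filterᵇ-map p f (x ∷ xs) with p (f x)
... | true  = cong (f x ∷_) (filterᵇ-map p f xs)
... | false = filterᵇ-map p f xs

filterᵇ-cong : {A : Set} {p q : A → Bool} {xs : List A} →
  All (λ x → p x ≡ q x) xs → filterᵇ p xs ≡ filterᵇ q xs
filterᵇ-cong [] = refl
filterᵇ-cong {p = p} {q} {x ∷ xs} (e ∷ es) with p x | q x | e
... | true  | true  | refl = cong (x ∷_) (filterᵇ-cong es)
... | false | false | refl = filterᵇ-cong es

filterᵇ-all : {A : Set} (p : A → Bool) {xs : List A} →
  All (λ x → p x ≡ true) xs → filterᵇ p xs ≡ xs
filterᵇ-all p [] = refl
filterᵇ-all p {x ∷ xs} (px ∷ pxs) with p x
filterᵇ-all p {x ∷ xs} (refl ∷ pxs) | true = cong (x ∷_) (filterᵇ-all p pxs)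

filterᵇ-none : {A : Set} (p : A → Bool) {xs : List A} →
  All (λ x → p x ≡ false) xs → filterᵇ p xs ≡ []
filterᵇ-none p [] = refl
filterᵇ-none p {x ∷ xs} (px ∷ pxs) with p x
filterᵇ-none p {x ∷ xs} (refl ∷ pxs) | false = filterᵇ-none p pxs

sum-const : {A : Set} (f : A → ℕ) (c : ℕ) (xs : List A) →
  All (λ x → f x ≡ c) xs → sum (map f xs) ≡ length xs * c
sum-const f c [] [] = refl
sum-const f c (x ∷ xs) (fx ∷ fxs) = cong₂ _+_ fx (sum-const f c xs fxs)

sublists-map : {A B : Set} (f : A → B) (xs : List A) →
  sublists (map f xs) ≡ map (map f) (sublists xs)
sublists-map f [] = refl
sublists-map f (x ∷ xs) = begin
    map (f x ∷_) (sublists (map f xs)) ++ sublists (map f xs)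
      ≡⟨ cong (λ r → map (f x ∷_) r ++ r) (sublists-map f xs) ⟩
    map (f x ∷_) (map (map f) S) ++ map (map f) S
      ≡⟨ cong (_++ map (map f) S) (trans (sym (map-∘ S)) (map-∘ S)) ⟩
    map (map f) (map (x ∷_) S) ++ map (map f) S
      ≡⟨ sym (map-++ (map f) (map (x ∷_) S) S) ⟩
    map (map f) (map (x ∷_) S ++ S) ∎
  where
    open ≡-Reasoning
    S = sublists xs

count : {A : Set} → (List A → Bool) → List A → ℕ
count Q xs = length (filterᵇ Q (sublists xs))

-- A sublist of x ∷ xs either contains x or is a sublist of xs.
count-∷ : {A : Set} (Q : List A → Bool) (x : A) (xs : List A) →
  count Q (x ∷ xs) ≡ count (Q ∘ (x ∷_)) xs + count Q xs
count-∷ Q x xs = begin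
    length (filterᵇ Q (map (x ∷_) S ++ S))
      ≡⟨ cong length (filter-++ (T? ∘ Q) (map (x ∷_) S) S) ⟩
    length (filterᵇ Q (map (x ∷_) S) ++ filterᵇ Q S)
      ≡⟨ length-++ (filterᵇ Q (map (x ∷_) S)) ⟩
    length (filterᵇ Q (map (x ∷_) S)) + count Q xs
      ≡⟨ cong (λ l → length l + count Q xs) (filterᵇ-map Q (x ∷_) S) ⟩
    length (map (x ∷_) (filterᵇ (Q ∘ (x ∷_)) S)) + count Q xs
      ≡⟨ cong (_+ count Q xs) (length-map (x ∷_) (filterᵇ (Q ∘ (x ∷_)) S)) ⟩
    count (Q ∘ (x ∷_)) xs + count Q xs ∎
  where
    open ≡-Reasoning
    S = sublists xs

count-cong : {A : Set} {Q Q′ : List A → Bool} → (∀ s → Q s ≡ Q′ s) →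
  (xs : List A) → count Q xs ≡ count Q′ xs
count-cong e xs = cong length (filterᵇ-cong (All.universal e (sublists xs)))

count-none : {A : Set} (Q : List A → Bool) (xs : List A) →
  (∀ s → Q s ≡ false) → count Q xs ≡ 0
count-none Q xs h = cong length (filterᵇ-none Q (All.universal h (sublists xs)))

count-all : {A : Set} (q : A → Bool) (Q : List A → Bool) (xs : List A) →
  count (λ s → all q s ∧ Q s) xs ≡ count Q (filterᵇ q xs)
count-all q Q [] with Q []
... | true  = refl
... | false = refl
count-all q Q (x ∷ xs) with q x in qx
... | true = begin
    count (λ s → all q s ∧ Q s) (x ∷ xs)
      ≡⟨ count-∷ (λ s → all q s ∧ Q s) x xs ⟩
    count (λ s → (q x ∧ all q s) ∧ Q (x ∷ s)) xs + count (λ s → all q s ∧ Q s) xs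
      ≡⟨ cong₂ _+_ (trans (count-cong (λ s → cong (λ b → (b ∧ all q s) ∧ Q (x ∷ s)) qx) xs)
                          (count-all q (Q ∘ (x ∷_)) xs))
                   (count-all q Q xs) ⟩
    count (Q ∘ (x ∷_)) (filterᵇ q xs) + count Q (filterᵇ q xs)
      ≡⟨ sym (count-∷ Q x (filterᵇ q xs)) ⟩
    count Q (x ∷ filterᵇ q xs) ∎
  where open ≡-Reasoning
... | false = begin
    count (λ s → all q s ∧ Q s) (x ∷ xs)
      ≡⟨ count-∷ (λ s → all q s ∧ Q s) x xs ⟩
    count (λ s → (q x ∧ all q s) ∧ Q (x ∷ s)) xs + count (λ s → all q s ∧ Q s) xs
      ≡⟨ cong₂ _+_ (count-none _ xs (λ s → cong (λ b → (b ∧ all q s) ∧ Q (x ∷ s)) qx))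
                   (count-all q Q xs) ⟩
    count Q (filterᵇ q xs) ∎
  where open ≡-Reasoning

-- Edges with natural-number endpoints.  Reading vertices through toℕ turns
-- the matchings of any Graph into matchings of such an edge list.
Edge : Set
Edge = ℕ × ℕ

meets : Edge → Edge → Bool
meets (a , b) (c , d) = (a ≡ᵇ c) ∨ (a ≡ᵇ d) ∨ (b ≡ᵇ c) ∨ (b ≡ᵇ d)

disjoint : Edge → Edge → Bool
disjoint e f = not (meets e f)

-- Pairwise disjointness, phrased with 'all' so that the first edge of a
-- matching restricts the rest by a filter.
isMatchingℕ : List Edge → Bool
isMatchingℕ []       = true
isMatchingℕ (e ∷ es) = all (disjoint e) es ∧ isMatchingℕ es

matchCount : List Edge → ℕ → ℕ
matchCount L t = count (λ s → (length s ≡ᵇ t) ∧ isMatchingℕ s) L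

matchCount-zero : (L : List Edge) → matchCount L 0 ≡ 1
matchCount-zero []      = refl
matchCount-zero (e ∷ L) =
  trans (count-∷ _ e L) (cong₂ _+_ (count-none _ L (λ s → refl)) (matchCount-zero L))

-- Deletion recurrence: a (t+1)-matching either avoids the first edge e, or
-- consists of e and a t-matching of the edges disjoint from e.
matchCount-∷ : (e : Edge) (L : List Edge) (t : ℕ) →
  matchCount (e ∷ L) (suc t) ≡ matchCount (filterᵇ (disjoint e) L) t + matchCount L (suc t)
matchCount-∷ e L t = trans (count-∷ _ e L) (cong (_+ matchCount L (suc t)) (begin
    count (λ s → (length s ≡ᵇ t) ∧ (all (disjoint e) s ∧ isMatchingℕ s)) L
      ≡⟨ count-cong (λ s → ∧-swap (length s ≡ᵇ t) (all (disjoint e) s) (isMatchingℕ s)) L ⟩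
    count (λ s → all (disjoint e) s ∧ ((length s ≡ᵇ t) ∧ isMatchingℕ s)) L
      ≡⟨ count-all (disjoint e) _ L ⟩
    matchCount (filterᵇ (disjoint e) L) t ∎))
  where
    open ≡-Reasoning
    ∧-swap : ∀ a b c → a ∧ (b ∧ c) ≡ b ∧ (a ∧ c)
    ∧-swap a b c = trans (sym (∧-assoc a b c))
                         (trans (cong (_∧ c) (∧-comm a b)) (∧-assoc b a c))

toPair : {n : ℕ} → Fin n × Fin n → Edge
toPair (i , j) = (toℕ i , toℕ j)

isMatching-toPair : {n : ℕ} (es : List (Fin n × Fin n)) →
  isMatching es ≡ isMatchingℕ (map toPair es)
isMatching-toPair []       = refl
isMatching-toPair {n} (e ∷ es) = cong₂ _∧_ (noneMeet es) (isMatching-toPair es)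
  where
    noneMeet : ∀ fs → not (anyB {n} (sharesVertex e) fs) ≡ all (disjoint (toPair e)) (map toPair fs)
    noneMeet []       = refl
    noneMeet (f ∷ fs) with sharesVertex e f
    ... | true  = refl
    ... | false = noneMeet fs

matchings-as-matchCount : (G : Graph) (t : ℕ) →
  matchings G t ≡ matchCount (map toPair (edges G)) t
matchings-as-matchCount G t = begin
    length (filterᵇ QG (sublists (edges G)))
      ≡⟨ cong length (filterᵇ-cong (All.universal (λ s → cong₂ _∧_ (cong (_≡ᵇ t) (sym (length-map toPair s)))
                                                                   (isMatching-toPair s)) (sublists (edges G)))) ⟩
    length (filterᵇ (Q ∘ map toPair) (sublists (edges G)))
      ≡⟨ sym (length-map (map toPair) (filterᵇ (Q ∘ map toPair) (sublists (edges G)))) ⟩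
    length (map (map toPair) (filterᵇ (Q ∘ map toPair) (sublists (edges G))))
      ≡⟨ cong length (sym (filterᵇ-map Q (map toPair) (sublists (edges G)))) ⟩
    length (filterᵇ Q (map (map toPair) (sublists (edges G))))
      ≡⟨ cong (length ∘ filterᵇ Q) (sym (sublists-map toPair (edges G))) ⟩
    matchCount (map toPair (edges G)) t ∎
  where
    open ≡-Reasoning
    QG : List (Fin (order G) × Fin (order G)) → Bool
    QG s = (length s ≡ᵇ t) ∧ isMatching s
    Q : List Edge → Bool
    Q s = (length s ≡ᵇ t) ∧ isMatchingℕ s

star : ℕ → List ℕ → List Edge
star v W = map (v ,_) W

cliqueEdges : List ℕ → List Edge
cliqueEdges []      = []
cliqueEdges (v ∷ V) = star v V ++ cliqueEdges V

Avoids : ℕ → List Edge → Set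
Avoids u Y = All (λ e → u ≢ proj₁ e × u ≢ proj₂ e) Y

remove : ℕ → List ℕ → List ℕ
remove w = filterᵇ (λ u → not (w ≡ᵇ u))

length-remove : ∀ {w} V → w ∈ V → Unique V → suc (length (remove w V)) ≡ length V
length-remove {w} (u ∷ U) (here refl) (w∉U ∷ _) rewrite ≡ᵇ-refl w =
  cong (suc ∘ length) (filterᵇ-all _ (All.map (cong not ∘ ≡ᵇ-≢) w∉U))
length-remove {w} (u ∷ U) (there w∈U) (u∉U ∷ uniq)
  rewrite ≡ᵇ-≢ (λ w≡u → All.lookup u∉U w∈U (sym w≡u)) = cong suc (length-remove U w∈U uniq)

filter-star-at-endpoint : ∀ v w u U → u ≡ v ⊎ u ≡ w →
  filterᵇ (disjoint (v , w)) (star u U) ≡ []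
filter-star-at-endpoint v w u U u∈vw =
  trans (filterᵇ-map _ (u ,_) U) (cong (map (u ,_)) (filterᵇ-none _ (All.universal (cong not ∘ meets-at u∈vw) U)))
  where
    meets-at : u ≡ v ⊎ u ≡ w → ∀ x → meets (v , w) (u , x) ≡ true
    meets-at (inj₁ refl) x rewrite ≡ᵇ-refl v = refl
    meets-at (inj₂ refl) x rewrite ≡ᵇ-refl w =
      trans (cong ((v ≡ᵇ w) ∨_) (∨-zeroʳ (v ≡ᵇ x))) (∨-zeroʳ (v ≡ᵇ w))

filter-avoiding : ∀ v w Y → Avoids v Y → Avoids w Y → filterᵇ (disjoint (v , w)) Y ≡ Y
filter-avoiding v w Y avV avW = filterᵇ-all _ (All.zipWith disjoint-edge (avV , avW))
  where
    disjoint-edge : ∀ {e} → (v ≢ proj₁ e × v ≢ proj₂ e) × (w ≢ proj₁ e × w ≢ proj₂ e) →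
      disjoint (v , w) e ≡ true
    disjoint-edge ((v≢c , v≢d) , (w≢c , w≢d))
      rewrite ≡ᵇ-≢ v≢c | ≡ᵇ-≢ v≢d | ≡ᵇ-≢ w≢c | ≡ᵇ-≢ w≢d = refl

avoids-clique : ∀ {u} U → All (u ≢_) U → Avoids u (cliqueEdges U)
avoids-clique []      _           = []
avoids-clique (x ∷ U) (u≢x ∷ u∉U) =
  All.++⁺ (All.map⁺ (All.map (u≢x ,_) u∉U)) (avoids-clique U u∉U)

filter-clique : ∀ v w V → All (v ≢_) V →
  filterᵇ (disjoint (v , w)) (cliqueEdges V) ≡ cliqueEdges (remove w V)
filter-clique v w [] _ = refl
filter-clique v w (u ∷ U) (v≢u ∷ v∉U) with w ≡ᵇ u in w=u
... | true = begin
    filterᵇ (disjoint (v , w)) (star u U ++ cliqueEdges U)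
      ≡⟨ filter-++ (T? ∘ disjoint (v , w)) (star u U) (cliqueEdges U) ⟩
    filterᵇ (disjoint (v , w)) (star u U) ++ filterᵇ (disjoint (v , w)) (cliqueEdges U)
      ≡⟨ cong₂ _++_ (filter-star-at-endpoint v w u U (inj₂ (sym (≡ᵇ⇒≡ w u (subst T (sym w=u) tt)))))
                    (filter-clique v w U v∉U) ⟩
    cliqueEdges (remove w U) ∎
  where open ≡-Reasoning
... | false = begin
    filterᵇ (disjoint (v , w)) (star u U ++ cliqueEdges U)
      ≡⟨ filter-++ (T? ∘ disjoint (v , w)) (star u U) (cliqueEdges U) ⟩
    filterᵇ (disjoint (v , w)) (star u U) ++ filterᵇ (disjoint (v , w)) (cliqueEdges U)
      ≡⟨ cong₂ _++_ (trans (filterᵇ-map _ (u ,_) U) (cong (map (u ,_)) (filterᵇ-cong (All.map star-edge v∉U))))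
                    (filter-clique v w U v∉U) ⟩
    star u (remove w U) ++ cliqueEdges (remove w U) ∎
  where
    open ≡-Reasoning
    star-edge : ∀ {x} → v ≢ x → disjoint (v , w) (u , x) ≡ not (w ≡ᵇ x)
    star-edge v≢x rewrite ≡ᵇ-≢ v≢u | ≡ᵇ-≢ v≢x | w=u = refl

filter-clique-beside : ∀ v w V Y → All (v ≢_) V → Avoids v Y → Avoids w Y →
  filterᵇ (disjoint (v , w)) (cliqueEdges V ++ Y) ≡ cliqueEdges (remove w V) ++ Y
filter-clique-beside v w V Y v∉V avV avW =
  trans (filter-++ (T? ∘ disjoint (v , w)) (cliqueEdges V) Y)
        (cong₂ _++_ (filter-clique v w V v∉V) (filter-avoiding v w Y avV avW))

-- Vertex recurrence at the centre v of a star: a (t+1)-matching of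
-- star v W ++ R either leaves v unmatched or matches it to some w ∈ W.
matchCount-star : ∀ v W R t →
  matchCount (star v W ++ R) (suc t)
    ≡ matchCount R (suc t) + sum (map (λ w → matchCount (filterᵇ (disjoint (v , w)) R) t) W)
matchCount-star v []      R t = sym (+-identityʳ _)
matchCount-star v (w ∷ W) R t = begin
    matchCount ((v , w) ∷ (star v W ++ R)) (suc t)
      ≡⟨ matchCount-∷ (v , w) (star v W ++ R) t ⟩
    matchCount (filterᵇ (disjoint (v , w)) (star v W ++ R)) t + matchCount (star v W ++ R) (suc t)
      ≡⟨ cong₂ _+_ (cong (λ L → matchCount L t) only-R) (matchCount-star v W R t) ⟩
    through w + (matchCount R (suc t) + rest)
      ≡⟨ +-comm (through w) _ ⟩
    (matchCount R (suc t) + rest) + through w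
      ≡⟨ +-assoc (matchCount R (suc t)) rest (through w) ⟩
    matchCount R (suc t) + (rest + through w)
      ≡⟨ cong (matchCount R (suc t) +_) (+-comm rest (through w)) ⟩
    matchCount R (suc t) + (through w + rest) ∎
  where
    open ≡-Reasoning
    through : ℕ → ℕ
    through x = matchCount (filterᵇ (disjoint (v , x)) R) t
    rest : ℕ
    rest = sum (map through W)
    only-R : filterᵇ (disjoint (v , w)) (star v W ++ R) ≡ filterᵇ (disjoint (v , w)) R
    only-R = trans (filter-++ (T? ∘ disjoint (v , w)) (star v W) R)
                   (cong (_++ _) (filter-star-at-endpoint v w v W (inj₁ refl)))

-- cliqueCount n c t: the number of t-matchings of K_n ⊔ H, where c counts
-- the matchings of H (see cliqueCount-suc for the uniform recurrence).
cliqueCount : ℕ → (ℕ → ℕ) → ℕ → ℕ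
cliqueCount zero          c t       = c t
cliqueCount (suc n)       c zero    = 1
cliqueCount (suc zero)    c (suc t) = c (suc t)
cliqueCount (suc (suc n)) c (suc t) = cliqueCount (suc n) c (suc t) + suc n * cliqueCount n c t

-- A new clique vertex is unmatched, or matched to one of the n others.
cliqueCount-suc : ∀ n c t →
  cliqueCount (suc n) c (suc t) ≡ cliqueCount n c (suc t) + n * cliqueCount (n ∸ 1) c t
cliqueCount-suc zero    c t = sym (+-identityʳ _)
cliqueCount-suc (suc n) c t = refl

cliqueCount-cong : ∀ n {c c′ : ℕ → ℕ} → (∀ s → c s ≡ c′ s) → ∀ t →
  cliqueCount n c t ≡ cliqueCount n c′ t
cliqueCount-cong zero          e t       = e t
cliqueCount-cong (suc n)       e zero    = refl
cliqueCount-cong (suc zero)    e (suc t) = e (suc t)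
cliqueCount-cong (suc (suc n)) e (suc t) =
  cong₂ _+_ (cliqueCount-cong (suc n) e (suc t)) (cong (suc n *_) (cliqueCount-cong n e t))

cliqueCount-zero : ∀ n c → c 0 ≡ 1 → cliqueCount n c 0 ≡ 1
cliqueCount-zero zero    c c0 = c0
cliqueCount-zero (suc n) c c0 = refl

cliqueCount-one : ∀ c → c 0 ≡ 1 → ∀ t → cliqueCount 1 c t ≡ c t
cliqueCount-one c c0 zero    = sym c0
cliqueCount-one c c0 (suc t) = refl

matchCount-clique : ∀ n V Y t → length V ≡ n → Unique V → All (λ u → Avoids u Y) V →
  matchCount (cliqueEdges V ++ Y) t ≡ cliqueCount n (matchCount Y) t
matchCount-clique zero    []      Y t       _   _             _           = refl
matchCount-clique (suc n) (v ∷ V) Y zero    _   _             _           = matchCount-zero (cliqueEdges (v ∷ V) ++ Y)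
matchCount-clique (suc n) (v ∷ V) Y (suc t) len (v∉V ∷ uniq) (avV ∷ avs) = begin
    matchCount ((star v V ++ cliqueEdges V) ++ Y) (suc t)
      ≡⟨ cong (λ L → matchCount L (suc t)) (++-assoc (star v V) (cliqueEdges V) Y) ⟩
    matchCount (star v V ++ (cliqueEdges V ++ Y)) (suc t)
      ≡⟨ matchCount-star v V (cliqueEdges V ++ Y) t ⟩
    matchCount (cliqueEdges V ++ Y) (suc t) + sum (map through V)
      ≡⟨ cong₂ _+_ (matchCount-clique n V Y (suc t) len′ uniq avs)
                   (sum-const through _ V (All.tabulate through-w)) ⟩
    cliqueCount n c (suc t) + length V * cliqueCount (n ∸ 1) c t
      ≡⟨ cong (λ k → cliqueCount n c (suc t) + k * cliqueCount (n ∸ 1) c t) len′ ⟩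
    cliqueCount n c (suc t) + n * cliqueCount (n ∸ 1) c t
      ≡⟨ sym (cliqueCount-suc n c t) ⟩
    cliqueCount (suc n) c (suc t) ∎
  where
    open ≡-Reasoning
    c = matchCount Y
    len′ : length V ≡ n
    len′ = suc-injective len
    through : ℕ → ℕ
    through w = matchCount (filterᵇ (disjoint (v , w)) (cliqueEdges V ++ Y)) t
    -- matching v to w leaves the clique on V without w, next to Y
    through-w : ∀ {w} → w ∈ V → through w ≡ cliqueCount (n ∸ 1) c t
    through-w {w} w∈V =
      trans (cong (λ L → matchCount L t) (filter-clique-beside v w V Y v∉V avV (All.lookup avs w∈V)))
            (smaller n len′)
      where
        smaller : ∀ m → length V ≡ m → matchCount (cliqueEdges (remove w V) ++ Y) t ≡ cliqueCount (m ∸ 1) c t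
        smaller zero    l with () ← trans (length-remove V w∈V uniq) l
        smaller (suc m) l = matchCount-clique m (remove w V) Y t
          (suc-injective (trans (length-remove V w∈V uniq) l))
          (Unique.filter⁺ (T? ∘ λ u → not (w ≡ᵇ u)) uniq) (All.filter⁺ (T? ∘ λ u → not (w ≡ᵇ u)) avs)

interval : ℕ → ℕ → List ℕ
interval lo zero    = []
interval lo (suc k) = lo ∷ interval (suc lo) k

∈-interval : ∀ {j} lo k → j ∈ interval lo k → lo ≤ j × j < lo + k
∈-interval lo (suc k) (here refl) = ≤-refl , m<m+n lo z<s
∈-interval {j} lo (suc k) (there j∈) with lo<j , j<hi ← ∈-interval (suc lo) k j∈ =
  <⇒≤ lo<j , subst (j <_) (sym (+-suc lo k)) j<hi

all-interval : {P : ℕ → Set} (lo k : ℕ) → (∀ j → lo ≤ j → j < lo + k → P j) → All P (interval lo k)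
all-interval lo k h = All.tabulate (λ j∈ → let lo≤j , j<hi = ∈-interval lo k j∈ in h _ lo≤j j<hi)

length-interval : ∀ lo k → length (interval lo k) ≡ k
length-interval lo zero    = refl
length-interval lo (suc k) = cong suc (length-interval (suc lo) k)

unique-interval : ∀ lo k → Unique (interval lo k)
unique-interval lo zero    = []
unique-interval lo (suc k) =
  all-interval (suc lo) k (λ j lo<j _ → <⇒≢ lo<j) ∷ unique-interval (suc lo) k

interval-++ : ∀ lo k l → interval lo (k + l) ≡ interval lo k ++ interval (lo + k) l
interval-++ lo zero    l = cong (λ x → interval x l) (sym (+-identityʳ lo))
interval-++ lo (suc k) l =
  cong (lo ∷_) (trans (interval-++ (suc lo) k l) (cong (λ x → interval (suc lo) k ++ interval x l) (sym (+-suc lo k))))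

interval-split : ∀ {lo mid hi} → lo ≤ mid → mid ≤ hi →
  interval lo (hi ∸ lo) ≡ interval lo (mid ∸ lo) ++ interval mid (hi ∸ mid)
interval-split {lo} {mid} {hi} lo≤mid mid≤hi = begin
    interval lo (hi ∸ lo)
      ≡⟨ cong (interval lo) lengths ⟩
    interval lo ((mid ∸ lo) + (hi ∸ mid))
      ≡⟨ interval-++ lo (mid ∸ lo) (hi ∸ mid) ⟩
    interval lo (mid ∸ lo) ++ interval (lo + (mid ∸ lo)) (hi ∸ mid)
      ≡⟨ cong (λ x → interval lo (mid ∸ lo) ++ interval x (hi ∸ mid)) (m+[n∸m]≡n lo≤mid) ⟩
    interval lo (mid ∸ lo) ++ interval mid (hi ∸ mid) ∎
  where
    open ≡-Reasoning
    lengths : hi ∸ lo ≡ (mid ∸ lo) + (hi ∸ mid)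
    lengths = begin
      hi ∸ lo                   ≡⟨ cong (_∸ lo) (sym (m∸n+n≡m mid≤hi)) ⟩
      (hi ∸ mid) + mid ∸ lo     ≡⟨ +-∸-assoc (hi ∸ mid) lo≤mid ⟩
      (hi ∸ mid) + (mid ∸ lo)   ≡⟨ +-comm (hi ∸ mid) (mid ∸ lo) ⟩
      (mid ∸ lo) + (hi ∸ mid)   ∎

filter-window : (p : ℕ → Bool) {th hi n : ℕ} → th ≤ hi → hi ≤ n →
  (∀ j → j < th → p j ≡ false) → (∀ j → th ≤ j → j < hi → p j ≡ true) →
  (∀ j → hi ≤ j → j < n → p j ≡ false) →
  filterᵇ p (interval 0 n) ≡ interval th (hi ∸ th)
filter-window p {th} {hi} {n} th≤hi hi≤n below inside above = begin
    filterᵇ p (interval 0 n)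
      ≡⟨ cong (filterᵇ p) (interval-split z≤n (≤-trans th≤hi hi≤n)) ⟩
    filterᵇ p (interval 0 th ++ interval th (n ∸ th))
      ≡⟨ cong (λ L → filterᵇ p (interval 0 th ++ L)) (interval-split th≤hi hi≤n) ⟩
    filterᵇ p (interval 0 th ++ (interval th (hi ∸ th) ++ interval hi (n ∸ hi)))
      ≡⟨ filter-++ (T? ∘ p) (interval 0 th) _ ⟩
    filterᵇ p (interval 0 th) ++ filterᵇ p (interval th (hi ∸ th) ++ interval hi (n ∸ hi))
      ≡⟨ cong (filterᵇ p (interval 0 th) ++_) (filter-++ (T? ∘ p) (interval th (hi ∸ th)) _) ⟩
    filterᵇ p (interval 0 th) ++ (filterᵇ p (interval th (hi ∸ th)) ++ filterᵇ p (interval hi (n ∸ hi)))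
      ≡⟨ cong₂ (λ L M → L ++ (M ++ filterᵇ p (interval hi (n ∸ hi))))
               (filterᵇ-none p bottom) (filterᵇ-all p middle) ⟩
    interval th (hi ∸ th) ++ filterᵇ p (interval hi (n ∸ hi))
      ≡⟨ cong (interval th (hi ∸ th) ++_) (filterᵇ-none p top) ⟩
    interval th (hi ∸ th) ++ []
      ≡⟨ ++-identityʳ _ ⟩
    interval th (hi ∸ th) ∎
  where
    open ≡-Reasoning
    bottom : All (λ j → p j ≡ false) (interval 0 th)
    bottom = all-interval 0 th (λ j _ j<th → below j j<th)
    middle : All (λ j → p j ≡ true) (interval th (hi ∸ th))
    middle = all-interval th (hi ∸ th) (λ j th≤j j< → inside j th≤j (subst (j <_) (m+[n∸m]≡n th≤hi) j<))
    top : All (λ j → p j ≡ false) (interval hi (n ∸ hi))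
    top = all-interval hi (n ∸ hi) (λ j hi≤j j< → above j hi≤j (subst (j <_) (m+[n∸m]≡n hi≤n) j<))

outside-interval : ∀ {x} lo k → x < lo ⊎ lo + k ≤ x → All (x ≢_) (interval lo k)
outside-interval lo k (inj₁ x<lo)  = all-interval lo k (λ j lo≤j _ → <⇒≢ (<-≤-trans x<lo lo≤j))
outside-interval lo k (inj₂ hi≤x) = all-interval lo k (λ j _ j<hi → ≢-sym (<⇒≢ (<-≤-trans j<hi hi≤x)))

intervals-apart : ∀ lo k lo′ k′ → lo + k ≤ lo′ → All (λ v → All (v ≢_) (interval lo′ k′)) (interval lo k)
intervals-apart lo k lo′ k′ hi≤lo′ =
  all-interval lo k (λ v _ v<hi → outside-interval lo′ k′ (inj₁ (<-≤-trans v<hi hi≤lo′)))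

adjK1 : ℕ → ℕ → ℕ → Bool
adjK1 a x y = not (x ≡ᵇ y) ∧
  ( ((x <ᵇ a) ∧ (y <ᵇ a))
  ∨ (not (x <ᵇ a) ∧ not (y <ᵇ a))
  ∨ ((x ≡ᵇ 0) ∧ (y ≡ᵇ a))
  ∨ ((x ≡ᵇ a) ∧ (y ≡ᵇ 0)) )

upEdge : ℕ → ℕ → ℕ → Bool
upEdge a i j = (i <ᵇ j) ∧ adjK1 a i j

upNeighbours : ℕ → ℕ → ℕ → List ℕ
upNeighbours a n i = filterᵇ (upEdge a i) (interval 0 n)

map-toℕ-allFin : ∀ n → map toℕ (allFin n) ≡ interval 0 n
map-toℕ-allFin n = trans (map-tabulate id toℕ) (shifted n 0 toℕ (λ i → refl))
  where
    shifted : ∀ n lo (f : Fin n → ℕ) → (∀ i → f i ≡ lo + toℕ i) → tabulate f ≡ interval lo n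
    shifted zero    lo f e = refl
    shifted (suc n) lo f e = cong₂ _∷_ (trans (e Fin.zero) (+-identityʳ lo))
      (shifted n (suc lo) (f ∘ Fin.suc) (λ i → trans (e (Fin.suc i)) (+-suc lo (toℕ i))))

edges-K1 : ∀ a b → map toPair (edges (K1 a b))
  ≡ concatMap (λ i → star i (upNeighbours a (a + b) i)) (interval 0 (a + b))
edges-K1 a b = begin
    map toPair (concatMap row (allFin n))
      ≡⟨ map-concatMap toPair row (allFin n) ⟩
    concatMap (map toPair ∘ row) (allFin n)
      ≡⟨ concatMap-cong (λ i → trans (map-concatMap toPair (cell i) (allFin n))
                                (trans (concatMap-cong (pick-toPair i) (allFin n))
                                       (trans (sym (concatMap-map (pick (toℕ i)) toℕ (allFin n)))
                                              (cong (concatMap (pick (toℕ i))) (map-toℕ-allFin n)))))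
                        (allFin n) ⟩
    concatMap (λ i → concatMap (pick (toℕ i)) (interval 0 n)) (allFin n)
      ≡⟨ sym (concatMap-map (λ x → concatMap (pick x) (interval 0 n)) toℕ (allFin n)) ⟩
    concatMap (λ x → concatMap (pick x) (interval 0 n)) (map toℕ (allFin n))
      ≡⟨ cong (concatMap _) (map-toℕ-allFin n) ⟩
    concatMap (λ x → concatMap (pick x) (interval 0 n)) (interval 0 n)
      ≡⟨ concatMap-cong (λ x → concatMap-pick x (interval 0 n)) (interval 0 n) ⟩
    concatMap (λ x → star x (upNeighbours a n x)) (interval 0 n) ∎
  where
    open ≡-Reasoning
    n = a + b
    cell : Fin n → Fin n → List (Fin n × Fin n)
    cell i j = if (toℕ i <ᵇ toℕ j) ∧ adj (K1 a b) i j then (i , j) ∷ [] else []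
    row : Fin n → List (Fin n × Fin n)
    row i = concatMap (cell i) (allFin n)
    pick : ℕ → ℕ → List Edge
    pick x y = if upEdge a x y then (x , y) ∷ [] else []
    pick-toPair : ∀ i j → map toPair (cell i j) ≡ pick (toℕ i) (toℕ j)
    pick-toPair i j with upEdge a (toℕ i) (toℕ j)
    ... | true  = refl
    ... | false = refl
    concatMap-pick : ∀ x ys → concatMap (pick x) ys ≡ star x (filterᵇ (upEdge a x) ys)
    concatMap-pick x []       = refl
    concatMap-pick x (y ∷ ys) with upEdge a x y
    ... | true  = cong ((x , y) ∷_) (concatMap-pick x ys)
    ... | false = concatMap-pick x ys

upEdge-below : ∀ a {i j} → j ≤ i → upEdge a i j ≡ false
upEdge-below a j≤i rewrite <ᵇ-false j≤i = refl

upEdge-inside-A : ∀ a {i j} → i < j → j < a → upEdge a i j ≡ true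
upEdge-inside-A a i<j j<a
  rewrite <ᵇ-true i<j | ≡ᵇ-≢ (<⇒≢ i<j) | <ᵇ-true (<-trans i<j j<a) | <ᵇ-true j<a = refl

upEdge-A-to-B : ∀ a {i j} → 1 ≤ i → i < a → a ≤ j → upEdge a i j ≡ false
upEdge-A-to-B a {i} {j} 1≤i i<a a≤j
  rewrite <ᵇ-true (<-≤-trans i<a a≤j) | ≡ᵇ-≢ (<⇒≢ (<-≤-trans i<a a≤j)) | <ᵇ-true i<a
        | <ᵇ-false a≤j | ≡ᵇ-≢ (≢-sym (<⇒≢ 1≤i)) | ≡ᵇ-≢ (<⇒≢ i<a) = refl

upEdge-inside-B : ∀ a {i j} → a ≤ i → i < j → upEdge a i j ≡ true
upEdge-inside-B a a≤i i<j
  rewrite <ᵇ-true i<j | ≡ᵇ-≢ (<⇒≢ i<j) | <ᵇ-false a≤i | <ᵇ-false (≤-trans a≤i (<⇒≤ i<j)) = refl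

upEdge-bridge : ∀ {a} → 1 ≤ a → upEdge a 0 a ≡ true
upEdge-bridge {a} 1≤a rewrite <ᵇ-true 1≤a | ≡ᵇ-≢ (<⇒≢ 1≤a) | <ᵇ-false (≤-refl {a}) | ≡ᵇ-refl a = refl

upEdge-0-beyond : ∀ {a j} → 1 ≤ a → a < j → upEdge a 0 j ≡ false
upEdge-0-beyond {a} {j} 1≤a a<j
  rewrite <ᵇ-true (<-trans 1≤a a<j) | ≡ᵇ-≢ (<⇒≢ (<-trans 1≤a a<j)) | <ᵇ-true 1≤a
        | <ᵇ-false (<⇒≤ a<j) | ≡ᵇ-≢ (≢-sym (<⇒≢ a<j)) | ≡ᵇ-≢ (<⇒≢ 1≤a) = refl

upNeighbours-0 : ∀ a′ b′ → upNeighbours (suc a′) (suc a′ + suc b′) 0 ≡ interval 1 (suc a′)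
upNeighbours-0 a′ b′ =
  filter-window (upEdge a 0) (s≤s z≤n) (subst (suc a ≤_) (sym (+-suc a b′)) (s≤s (m≤m+n a b′)))
  (λ j j<1 → upEdge-below a (≤-pred j<1)) inside (λ j a<j _ → upEdge-0-beyond (s≤s z≤n) a<j)
  where
    a = suc a′
    inside : ∀ j → 1 ≤ j → j < suc a → upEdge a 0 j ≡ true
    inside j 1≤j j≤a with m≤n⇒m<n∨m≡n (≤-pred j≤a)
    ... | inj₁ j<a  = upEdge-inside-A a 1≤j j<a
    ... | inj₂ refl = upEdge-bridge {a} (s≤s z≤n)

upNeighbours-A : ∀ {a n i} → 1 ≤ i → i < a → a ≤ n → upNeighbours a n i ≡ interval (suc i) (a ∸ suc i)
upNeighbours-A {a} {n} {i} 1≤i i<a a≤n = filter-window (upEdge a i) i<a a≤n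
  (λ j j≤i → upEdge-below a (≤-pred j≤i)) (λ j i<j j<a → upEdge-inside-A a i<j j<a)
  (λ j a≤j _ → upEdge-A-to-B a 1≤i i<a a≤j)

upNeighbours-B : ∀ {a n i} → a ≤ i → i < n → upNeighbours a n i ≡ interval (suc i) (n ∸ suc i)
upNeighbours-B {a} {n} {i} a≤i i<n = filter-window (upEdge a i) i<n ≤-refl
  (λ j j≤i → upEdge-below a (≤-pred j≤i)) (λ j i<j _ → upEdge-inside-B a a≤i i<j)
  (λ j n≤j j<n → contradiction j<n (≤⇒≯ n≤j))

concatMap-upper-rows : (R : ℕ → List Edge) (lo k hi : ℕ) → lo + k ≡ hi →
  (∀ i → lo ≤ i → i < hi → R i ≡ star i (interval (suc i) (hi ∸ suc i))) →
  concatMap R (interval lo k) ≡ cliqueEdges (interval lo k)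
concatMap-upper-rows R lo zero    hi _   rows = refl
concatMap-upper-rows R lo (suc k) hi eq rows = cong₂ _++_
  (trans (rows lo ≤-refl (subst (lo <_) eq (m<m+n lo z<s))) (cong (star lo ∘ interval (suc lo)) rest))
  (concatMap-upper-rows R (suc lo) k hi (trans (sym (+-suc lo k)) eq) (λ i lo<i → rows i (<⇒≤ lo<i)))
  where
    rest : hi ∸ suc lo ≡ k
    rest = trans (cong (_∸ suc lo) (trans (sym eq) (+-suc lo k))) (m+n∸m≡n (suc lo) k)

edges-K1-shape : ∀ a′ b′ → map toPair (edges (K1 (suc a′) (suc b′)))
  ≡ star 0 (interval 1 a′) ++ (0 , suc a′)
      ∷ (cliqueEdges (interval 1 a′) ++ cliqueEdges (interval (suc a′) (suc b′)))
edges-K1-shape a′ b′ = begin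
    map toPair (edges (K1 a b))
      ≡⟨ edges-K1 a b ⟩
    R 0 ++ concatMap R (interval 1 (a′ + b))
      ≡⟨ cong (λ L → R 0 ++ concatMap R L) (interval-++ 1 a′ b) ⟩
    R 0 ++ concatMap R (W ++ U)
      ≡⟨ cong (R 0 ++_) (concatMap-++ R W U) ⟩
    R 0 ++ (concatMap R W ++ concatMap R U)
      ≡⟨ cong₂ (λ L M → L ++ M) row-0
               (cong₂ _++_ (concatMap-upper-rows R 1 a′ a refl
                              (λ i 1≤i i<a → cong (star i) (upNeighbours-A 1≤i i<a (m≤m+n a b))))
                           (concatMap-upper-rows R a b (a + b) refl
                              (λ i a≤i i<n → cong (star i) (upNeighbours-B a≤i i<n)))) ⟩
    (star 0 W ++ (0 , a) ∷ []) ++ (cliqueEdges W ++ cliqueEdges U)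
      ≡⟨ ++-assoc (star 0 W) ((0 , a) ∷ []) _ ⟩
    star 0 W ++ (0 , a) ∷ (cliqueEdges W ++ cliqueEdges U) ∎
  where
    open ≡-Reasoning
    a = suc a′
    b = suc b′
    W = interval 1 a′
    U = interval a b
    R : ℕ → List Edge
    R i = star i (upNeighbours a (a + b) i)
    row-0 : R 0 ≡ star 0 W ++ (0 , a) ∷ []
    row-0 = begin
      star 0 (upNeighbours a (a + b) 0)     ≡⟨ cong (star 0) (upNeighbours-0 a′ b′) ⟩
      star 0 (interval 1 a)                 ≡⟨ cong (star 0 ∘ interval 1) (+-comm 1 a′) ⟩
      star 0 (interval 1 (a′ + 1))          ≡⟨ cong (star 0) (interval-++ 1 a′ 1) ⟩
      star 0 (W ++ a ∷ [])                  ≡⟨ map-++ (0 ,_) W (a ∷ []) ⟩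
      star 0 W ++ (0 , a) ∷ []              ∎

-- mK n t = m(K_n , t) and mKK a b t = m(K_a ⊔ K_b , t).
mK : ℕ → ℕ → ℕ
mK n = cliqueCount n (matchCount [])

mKK : ℕ → ℕ → ℕ → ℕ
mKK a b = cliqueCount a (mK b)

-- The paper's formula: m(K^1_{a,b} , t) counts the matchings avoiding the
-- bridge, m(K_a ⊔ K_b , t), plus those through it, m(K_{a-1} ⊔ K_{b-1} , t-1).
mK1 : ℕ → ℕ → ℕ → ℕ
mK1 a b zero    = 1
mK1 a b (suc t) = mKK a b (suc t) + mKK (a ∸ 1) (b ∸ 1) t

matchCount-two-cliques : ∀ V U t → Unique V → Unique U → All (λ v → All (v ≢_) U) V →
  matchCount (cliqueEdges V ++ cliqueEdges U) t ≡ mKK (length V) (length U) t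
matchCount-two-cliques V U t uniqV uniqU apart =
  trans (matchCount-clique (length V) V (cliqueEdges U) t refl uniqV (All.map (avoids-clique U) apart))
        (cliqueCount-cong (length V) clique-U t)
  where
    clique-U : ∀ s → matchCount (cliqueEdges U) s ≡ mK (length U) s
    clique-U s = trans (cong (λ L → matchCount L s) (sym (++-identityʳ (cliqueEdges U))))
                       (matchCount-clique (length U) U [] s refl uniqU (All.universal (λ _ → []) U))

matchCount-two-intervals : ∀ lo k lo′ k′ t → lo + k ≤ lo′ →
  matchCount (cliqueEdges (interval lo k) ++ cliqueEdges (interval lo′ k′)) t ≡ mKK k k′ t
matchCount-two-intervals lo k lo′ k′ t hi≤lo′ =
  trans (matchCount-two-cliques (interval lo k) (interval lo′ k′) t (unique-interval lo k) (unique-interval lo′ k′)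
                                (intervals-apart lo k lo′ k′ hi≤lo′))
        (cong₂ (λ x y → mKK x y t) (length-interval lo k) (length-interval lo′ k′))

module BridgeCount (a′ b′ : ℕ) where
  a b : ℕ
  a = suc a′
  b = suc b′
  -- K_a - 0, K_b, and K_b - a
  W U U′ : List ℕ
  W  = interval 1 a′
  U  = interval a b
  U′ = interval (suc a) b′
  Z : List Edge
  Z = cliqueEdges W ++ cliqueEdges U


  -- Matchings through the bridge (0 , a) leave K_a - 0 and K_b - a; the
  -- others are the matchings of Z.
  bridge : ∀ {t} → matchCount ((0 , a) ∷ Z) (suc t) ≡ mKK a′ b′ t + mKK a′ b (suc t)
  bridge {t} = begin
      matchCount ((0 , a) ∷ Z) (suc t)
        ≡⟨ matchCount-∷ (0 , a) Z t ⟩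
      matchCount (filterᵇ (disjoint (0 , a)) Z) t + matchCount Z (suc t)
        ≡⟨ cong (λ L → matchCount L t + matchCount Z (suc t)) remaining ⟩
      matchCount (cliqueEdges W ++ cliqueEdges U′) t + matchCount Z (suc t)
        ≡⟨ cong₂ _+_ (matchCount-two-intervals 1 a′ (suc a) b′ t (n≤1+n a))
                     (matchCount-two-intervals 1 a′ a b (suc t) ≤-refl) ⟩
      mKK a′ b′ t + mKK a′ b (suc t) ∎
    where
      open ≡-Reasoning
      0∉W : All (0 ≢_) W
      0∉W = outside-interval 1 a′ (inj₁ z<s)
      a∉W : All (a ≢_) W
      a∉W = outside-interval 1 a′ (inj₂ ≤-refl)
      0∉U′ : All (0 ≢_) U′
      0∉U′ = outside-interval (suc a) b′ (inj₁ z<s)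
      a∉U′ : All (a ≢_) U′
      a∉U′ = outside-interval (suc a) b′ (inj₁ ≤-refl)
      remaining : filterᵇ (disjoint (0 , a)) Z ≡ cliqueEdges W ++ cliqueEdges U′
      remaining = begin
        filterᵇ (disjoint (0 , a)) (cliqueEdges W ++ (star a U′ ++ cliqueEdges U′))
          ≡⟨ filter-++ (T? ∘ disjoint (0 , a)) (cliqueEdges W) _ ⟩
        filterᵇ (disjoint (0 , a)) (cliqueEdges W) ++ filterᵇ (disjoint (0 , a)) (star a U′ ++ cliqueEdges U′)
          ≡⟨ cong₂ _++_ (filter-avoiding 0 a (cliqueEdges W) (avoids-clique W 0∉W) (avoids-clique W a∉W))
                        (filter-++ (T? ∘ disjoint (0 , a)) (star a U′) (cliqueEdges U′)) ⟩
        cliqueEdges W ++ (filterᵇ (disjoint (0 , a)) (star a U′) ++ filterᵇ (disjoint (0 , a)) (cliqueEdges U′))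
          ≡⟨ cong (cliqueEdges W ++_)
                  (cong₂ _++_ (filter-star-at-endpoint 0 a a U′ (inj₂ refl))
                              (filter-avoiding 0 a (cliqueEdges U′)
                                 (avoids-clique U′ 0∉U′) (avoids-clique U′ a∉U′))) ⟩
        cliqueEdges W ++ cliqueEdges U′ ∎

  -- Matching 0 to w ∈ W leaves K_a - {0 , w} next to K_b.
  through-w : ∀ {w t} → w ∈ W → matchCount (filterᵇ (disjoint (0 , w)) ((0 , a) ∷ Z)) t ≡ mKK (a′ ∸ 1) b t
  through-w {w} {t} w∈W = begin
      matchCount (filterᵇ (disjoint (0 , w)) Z) t
        ≡⟨ cong (λ L → matchCount L t)
                (filter-clique-beside 0 w W (cliqueEdges U) 0∉W (avoids-clique U 0∉U) (avoids-clique U w∉U)) ⟩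
      matchCount (cliqueEdges (remove w W) ++ cliqueEdges U) t
        ≡⟨ matchCount-two-cliques (remove w W) U t uniq (unique-interval a b)
                                  (All.filter⁺ (T? ∘ keep) (intervals-apart 1 a′ a b ≤-refl)) ⟩
      mKK (length (remove w W)) (length U) t
        ≡⟨ cong₂ (λ k l → mKK k l t) smaller (length-interval a b) ⟩
      mKK (a′ ∸ 1) b t ∎
    where
      open ≡-Reasoning
      keep : ℕ → Bool
      keep u = not (w ≡ᵇ u)
      uniq : Unique (remove w W)
      uniq = Unique.filter⁺ (T? ∘ keep) (unique-interval 1 a′)
      smaller : length (remove w W) ≡ a′ ∸ 1
      smaller = cong (_∸ 1) (trans (length-remove W w∈W (unique-interval 1 a′)) (length-interval 1 a′))
      0∉W : All (0 ≢_) W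
      0∉W = outside-interval 1 a′ (inj₁ z<s)
      0∉U : All (0 ≢_) U
      0∉U = outside-interval a b (inj₁ z<s)
      w∉U : All (w ≢_) U
      w∉U = outside-interval a b (inj₁ (proj₂ (∈-interval 1 a′ w∈W)))

  -- Vertex 0 is matched through the bridge, to some w ∈ W, or not at all.
  matchCount-shape : ∀ t → matchCount (star 0 W ++ (0 , a) ∷ Z) (suc t) ≡ mK1 a b (suc t)
  matchCount-shape t = begin
      matchCount (star 0 W ++ (0 , a) ∷ Z) (suc t)
        ≡⟨ matchCount-star 0 W ((0 , a) ∷ Z) t ⟩
      matchCount ((0 , a) ∷ Z) (suc t) + sum (map (λ w → matchCount (filterᵇ (disjoint (0 , w)) ((0 , a) ∷ Z)) t) W)
        ≡⟨ cong₂ _+_ bridge (sum-const _ _ W (All.tabulate through-w)) ⟩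
      (mKK a′ b′ t + mKK a′ b (suc t)) + length W * mKK (a′ ∸ 1) b t
        ≡⟨ cong (λ k → (mKK a′ b′ t + mKK a′ b (suc t)) + k * mKK (a′ ∸ 1) b t) (length-interval 1 a′) ⟩
      (mKK a′ b′ t + mKK a′ b (suc t)) + a′ * mKK (a′ ∸ 1) b t
        ≡⟨ rearrange (mKK a′ b′ t) (mKK a′ b (suc t)) (a′ * mKK (a′ ∸ 1) b t) ⟩
      (mKK a′ b (suc t) + a′ * mKK (a′ ∸ 1) b t) + mKK a′ b′ t
        ≡⟨ cong (_+ mKK a′ b′ t) (sym (cliqueCount-suc a′ _ t)) ⟩
      mK1 a b (suc t) ∎
    where
      open ≡-Reasoning
      rearrange : ∀ x y z → (x + y) + z ≡ (y + z) + x
      rearrange = solve-∀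

matchings-K1 : ∀ a′ b′ t → matchings (K1 (suc a′) (suc b′)) t ≡ mK1 (suc a′) (suc b′) t
matchings-K1 a′ b′ zero    = trans (matchings-as-matchCount (K1 (suc a′) (suc b′)) 0)
                                   (matchCount-zero (map toPair (edges (K1 (suc a′) (suc b′)))))
matchings-K1 a′ b′ (suc t) = trans (matchings-as-matchCount (K1 (suc a′) (suc b′)) (suc t))
  (trans (cong (λ L → matchCount L (suc t)) (edges-K1-shape a′ b′)) (BridgeCount.matchCount-shape a′ b′ t))

-- Only the empty matching has size 0; bridge-free matchings are among all.
mKK-zero : ∀ x y → mKK x y 0 ≡ 1
mKK-zero x y = cliqueCount-zero x _ (cliqueCount-zero y _ refl)

-- Vertex recurrence on the K_a side: a new vertex of K_{x+2} is unmatched,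
-- matched to one of the x vertices other than the bridge end 0, or to 0.
mK1-grow : ∀ x y s → mK1 (suc (suc x)) y (suc s) ≡ mK1 (suc x) y (suc s) + x * mK1 x y s + mKK x y s
mK1-grow x y zero rewrite mKK-zero x y | mKK-zero x (y ∸ 1) | mKK-zero (suc x) (y ∸ 1) = arith (mKK (suc x) y 1) x
  where
    arith : ∀ A x → A + suc x * 1 + 1 ≡ (A + 1) + x * 1 + 1
    arith = solve-∀
mK1-grow x y (suc s) rewrite cliqueCount-suc x (mK (y ∸ 1)) s =
  arith (mKK (suc x) y (suc (suc s))) x (mKK x y (suc s)) (mKK x (y ∸ 1) (suc s)) (mKK (x ∸ 1) (y ∸ 1) s)
  where
    arith : ∀ A x Q R T → A + suc x * Q + (R + x * T) ≡ (A + R) + x * (Q + T) + Q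
    arith = solve-∀

mKK≤mK1 : ∀ x y s → mKK x y s ≤ mK1 x y s
mKK≤mK1 x y zero    = ≤-reflexive (mKK-zero x y)
mKK≤mK1 x y (suc s) = m≤m+n _ _

-- K1 1 n and K1 n 1 are the same graph up to relabelling.
mK1-flip : ∀ n t → mK1 1 n t ≡ mK1 n 1 t
mK1-flip n zero    = refl
mK1-flip n (suc t) = cong (_+ mK (n ∸ 1) t) (sym (cliqueCount-cong n (cliqueCount-one (matchCount []) refl) (suc t)))

mK1-two : ∀ b t → mK1 2 (suc b) t ≤ mK1 (suc (suc b)) 1 t
mK1-two b zero    = ≤-refl
mK1-two b (suc t) = begin
    mK (suc b) (suc t) + 1 * mK (suc b) t + mKK 1 b t
      ≡⟨ cong (mK (suc b) (suc t) + 1 * mK (suc b) t +_) (cliqueCount-one (mK b) (cliqueCount-zero b _ refl) t) ⟩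
    mK (suc b) (suc t) + 1 * mK (suc b) t + mK b t
      ≤⟨ +-monoʳ-≤ (mK (suc b) (suc t) + 1 * mK (suc b) t) (m≤m+n (mK b t) (b * mK b t)) ⟩
    mK (suc b) (suc t) + 1 * mK (suc b) t + suc b * mK b t
      ≡⟨ arith (mK (suc b) (suc t)) (mK (suc b) t) (mK b t) b ⟩
    (mK (suc b) (suc t) + suc b * mK b t) + mK (suc b) t
      ≡⟨ cong (_+ mK (suc b) t)
              (cliqueCount-cong (suc (suc b)) (λ s → sym (cliqueCount-one (matchCount []) refl s)) (suc t)) ⟩
    mK1 (suc (suc b)) 1 (suc t) ∎
  where
    open ≤-Reasoning
    arith : ∀ A B C b → A + 1 * B + (C + b * C) ≡ (A + suc b * C) + B
    arith = solve-∀

mK1-step : ∀ a c s → let n = a + suc c in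
  mK1 (suc (suc a)) (suc c) (suc s) ≤ mK1 (suc n) 1 (suc s) →
  mK1 (suc a) (suc c) s ≤ mK1 n 1 s →
  mKK (suc a) (suc c) s ≤ c * mK1 n 1 s + mKK n 1 s →
  mK1 (suc (suc (suc a))) (suc c) (suc s) ≤ mK1 (suc (suc n)) 1 (suc s)
mK1-step a c s ih-suc ih bridge-free = begin
    mK1 (suc (suc (suc a))) (suc c) (suc s)
      ≡⟨ mK1-grow (suc a) (suc c) s ⟩
    mK1 (suc (suc a)) (suc c) (suc s) + suc a * mK1 (suc a) (suc c) s + mKK (suc a) (suc c) s
      ≤⟨ +-mono-≤ (+-mono-≤ ih-suc (*-monoʳ-≤ (suc a) ih)) bridge-free ⟩
    mK1 (suc n) 1 (suc s) + suc a * G + (c * G + mKK n 1 s)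
      ≡⟨ arith (mK1 (suc n) 1 (suc s)) (suc a) c G (mKK n 1 s) ⟩
    mK1 (suc n) 1 (suc s) + (suc a + c) * G + mKK n 1 s
      ≡⟨ cong (λ k → mK1 (suc n) 1 (suc s) + k * G + mKK n 1 s) (sym (+-suc a c)) ⟩
    mK1 (suc n) 1 (suc s) + n * G + mKK n 1 s
      ≡⟨ sym (mK1-grow n 1 s) ⟩
    mK1 (suc (suc n)) 1 (suc s) ∎
  where
    open ≤-Reasoning
    n = a + suc c
    G = mK1 n 1 s
    arith : ∀ A x y G Q → A + x * G + (y * G + Q) ≡ A + (x + y) * G + Q
    arith = solve-∀

mK1-merge : ∀ a c t → mK1 (suc a) (suc c) t ≤ mK1 (a + suc c) 1 t
mK1-merge a c zero = ≤-refl
mK1-merge zero c (suc t) = ≤-reflexive (mK1-flip (suc c) (suc t))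
mK1-merge (suc zero) c (suc t) = mK1-two c (suc t)
-- b = 1: the bridge-free bound is an identity
mK1-merge (suc (suc a)) zero (suc s) =
  mK1-step a zero s (mK1-merge (suc a) zero (suc s)) (mK1-merge a zero s)
    (≤-trans (≤-reflexive (cong (λ k → mKK k 1 s) (+-comm 1 a))) (m≤n+m _ _))
-- b ≥ 2: bridge-free matchings are bounded via the induction hypothesis
mK1-merge (suc (suc a)) (suc c) (suc s) =
  mK1-step a (suc c) s (mK1-merge (suc a) (suc c) (suc s)) (mK1-merge a (suc c) s)
    (≤-trans (mKK≤mK1 (suc a) (suc (suc c)) s)
    (≤-trans (mK1-merge a (suc c) s)
    (≤-trans (m≤m+n G (c * G)) (m≤m+n _ _))))
  where G = mK1 (a + suc (suc c)) 1 s

K1-merge-≤ : ∀ a c t → matchings (K1 (suc a) (suc c)) t ≤ matchings (K1 (a + suc c) 1) t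
K1-merge-≤ a c t = begin
    matchings (K1 (suc a) (suc c)) t   ≡⟨ matchings-K1 a c t ⟩
    mK1 (suc a) (suc c) t              ≤⟨ mK1-merge a c t ⟩
    mK1 (a + suc c) 1 t                ≡⟨ cong (λ n → mK1 n 1 t) (+-suc a c) ⟩
    mK1 (suc (a + c)) 1 t              ≡⟨ sym (matchings-K1 (a + c) 0 t) ⟩
    matchings (K1 (suc (a + c)) 1) t   ≡⟨ cong (λ n → matchings (K1 n 1) t) (sym (+-suc a c)) ⟩
    matchings (K1 (a + suc c) 1) t     ∎
  where open ≤-Reasoning

lemma2p6 : (m : ℕ) → 1 ≤ m →
    ((t : ℕ) → t ≤ m → matchings (K1 m m) t ≤ matchings (K1 (2 * m ∸ 1) 1) t)
    × ((t : ℕ) → t ≤ m → matchings (K1 (m + 1) m) t ≤ matchings (K1 (2 * m) 1) t)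
lemma2p6 (suc k) _ = balanced , unbalanced
  where
    balanced : (t : ℕ) → t ≤ suc k → matchings (K1 (suc k) (suc k)) t ≤ matchings (K1 (2 * suc k ∸ 1) 1) t
    balanced t _ = subst (λ n → matchings (K1 (suc k) (suc k)) t ≤ matchings (K1 n 1) t)
                         size (K1-merge-≤ k k t)
      where
        size : k + suc k ≡ 2 * suc k ∸ 1
        size = cong (k +_) (cong suc (sym (+-identityʳ k)))
    unbalanced : (t : ℕ) → t ≤ suc k → matchings (K1 (suc k + 1) (suc k)) t ≤ matchings (K1 (2 * suc k) 1) t
    unbalanced t _ = subst (λ n → matchings (K1 (suc k + 1) (suc k)) t ≤ matchings (K1 n 1) t)
                           (size k) (K1-merge-≤ (k + 1) k t)
      where
        size : ∀ n → n + 1 + suc n ≡ 2 * suc n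
        size = solve-∀
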